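{- For all integers $n\geq k>d\geq 1$, \[\Psi(n,k,d)\leq T(n,k,d).\]
   Context: A box in $\mathbb{R}^d$ is an axis-parallel box, i.e. a Cartesian product of $d$ compact intervals (degenerate intervals allowed). A family of $n$ boxes is a list of $n$ boxes (repetitions allowed); an intersecting pair is an unordered pair of distinct members with nonempty intersection. For integers $n\geq k\geq 1$, $d\geq 1$, $T(n,k,d)$ is the maximum number of intersecting pairs in a family of $n$ boxes in $\mathbb{R}^d$ such that no $k+1$ members have a point in common. For integers $n\geq m\geq 1$, $t(n,m)$ is the number of edges of the Turán graph $\mathcal{T}(n,m)$ (complete $m$-partite graph on $n$ vertices with class sizes differing by at most one), $t(n,1)=0$. For $n\geq k>d\geq 1$, $\Psi(n,k,d)=t(n-k+d,d)+T(n,k-d+1,1)$.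
   Formalization: The boxes entering T(n,k,d) and T(n,k−d+1,1) have rational endpoints and their common points are taken in ℚ^d, rather than in ℝ^d. -}

module Defs where

open import Data.Nat using (ℕ; zero; suc; _+_; _*_; _∸_; _≤_; _<_)
open import Data.Nat.DivMod using (_/_; _%_)
open import Data.Fin using (Fin) renaming (_<_ to _<ᶠ_)
open import Data.Nat.ListAction using (sum)
open import Data.List using (List; []; _∷_; replicate; _++_; length)
open import Data.List.Relation.Unary.All using (All)
open import Data.List.Relation.Unary.Unique.Propositional using (Unique)
open import Data.Product using (Σ; _×_; ∃; _,_)
open import Data.Rational using (ℚ) renaming (_≤_ to _≤ℚ_)
open import Relation.Binary.PropositionalEquality using (_≡_)
open import Relation.Nullary using (¬_)

record Interval : Set where
  constructor [_,_]⟨_⟩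
  field
    lo hi : ℚ
    lo≤hi : lo ≤ℚ hi
open Interval public

Box : ℕ → Set
Box d = Fin d → Interval

Point : ℕ → Set
Point d = Fin d → ℚ

_∈ᴵ_ : ℚ → Interval → Set
x ∈ᴵ I = (lo I ≤ℚ x) × (x ≤ℚ hi I)

_∈ᴮ_ : ∀ {d} → Point d → Box d → Set
p ∈ᴮ B = ∀ i → p i ∈ᴵ B i

Family : ℕ → ℕ → Set
Family n d = Fin n → Box d

Meets : ∀ {n d} → Family n d → Fin n → Fin n → Set
Meets {d = d} F i j = Σ (Point d) λ p → (p ∈ᴮ F i) × (p ∈ᴮ F j)

-- An unordered pair of distinct members, represented as (i , j) with i < j.
Pair : ℕ → Set
Pair n = Σ (Fin n) λ i → Σ (Fin n) λ j → i <ᶠ j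

IntersectingPair : ∀ {n d} → Family n d → Pair n → Set
IntersectingPair F (i , j , _) = Meets F i j

AtLeastPairs : ∀ {n d} → Family n d → ℕ → Set
AtLeastPairs {n} F m =
  Σ (List (Pair n)) λ ps → Unique ps × All (IntersectingPair F) ps × length ps ≡ m

AtMostPairs : ∀ {n d} → Family n d → ℕ → Set
AtMostPairs {n} F m =
  (ps : List (Pair n)) → Unique ps → All (IntersectingPair F) ps → length ps ≤ m

NoCommonPoint : ∀ {n d} → ℕ → Family n d → Set
NoCommonPoint {n} {d} k F =
  (S : List (Fin n)) → Unique S → length S ≡ suc k →
  ¬ (Σ (Point d) λ p → All (λ i → p ∈ᴮ F i) S)

-- IsT n k d m  :  m = T(n,k,d), the maximum number of intersecting pairs in a
-- family of n boxes in dimension d with no k+1 members having a common point.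
IsT : ℕ → ℕ → ℕ → ℕ → Set
IsT n k d m =
  (Σ (Family n d) λ F → NoCommonPoint k F × AtLeastPairs F m)
  × ((F : Family n d) → NoCommonPoint k F → AtMostPairs F m)

multipartiteEdges : List ℕ → ℕ
multipartiteEdges [] = 0
multipartiteEdges (s ∷ ss) = s * sum ss + multipartiteEdges ss

turanSizes : ℕ → ℕ → List ℕ
turanSizes n zero = []
turanSizes n (suc m) =
  replicate (n % suc m) (suc (n / suc m)) ++ replicate (suc m ∸ n % suc m) (n / suc m)

t : ℕ → ℕ → ℕ
t n m = multipartiteEdges (turanSizes n m)

{-# OPTIONS --safe #-}
-- If no a + 2 of a family of intervals share a point, its intersection graph is a-degenerate: every interval
-- meeting the one with the leftmost right endpoint contains that endpoint. Hence T(n, a + 1, 1) ≤ ∑_{j<n} min(j, a).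
-- With a = k − d and b = n − k + d, this sum plus t(b, d) counts the intersecting pairs of the following n boxes
-- in dimension d: a copies of a large cube, and for every vertex x of the Turán graph T(b, d), of class c, the cube
-- with its c-th coordinate pinned to x. The cubes meet everything, two pinned boxes meet iff their classes differ,
-- and a point lies in at most one pinned box per class, so no k + 1 of the boxes share a point.

module Submission where

open import Defs
open import Data.Nat using (ℕ; zero; suc; _+_; _*_; _∸_; _⊓_; _≤_; _<_; z≤n; s≤s; s≤s⁻¹; z<s; _≟_; _<?_; _≤?_)
open import Data.Nat.Properties
open import Algebra.Properties.CommutativeSemigroup +-commutativeSemigroup using (interchange)
open import Data.Nat.Induction using (<-wellFounded)
open import Data.Nat.ListAction using (sum)
open import Data.Nat.ListAction.Properties using (sum-++)
open import Data.Fin as Fin using (Fin; toℕ; fromℕ<)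
import Data.Fin.Properties as Fin
open import Data.List using (List; []; _∷_; length; map; filter; lookup; take; replicate; _++_; upTo; allFin)
open import Data.List.Properties using (length-map; length-take; length-tabulate; length-++; length-replicate; length-upTo; filter-notAll)
open import Data.List.Membership.Propositional using (_∈_)
open import Data.List.Membership.Propositional.Properties using (∈-lookup; ∈-filter⁺; ∈-upTo⁺; ∈-allFin)
open import Data.List.Relation.Binary.Subset.Propositional using (_⊆_)
open import Data.List.Relation.Unary.All as All using (All; []; _∷_)
import Data.List.Relation.Unary.All.Properties as All
open import Data.List.Relation.Unary.Any as Any using (here; there; index)
open import Data.List.Relation.Unary.Any.Properties using (lookup-index)
open import Data.List.Relation.Unary.AllPairs using ([]; _∷_)
import Data.List.Relation.Unary.AllPairs.Properties as AllPairs
open import Data.List.Relation.Unary.Unique.Propositional using (Unique)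
import Data.List.Relation.Unary.Unique.Propositional.Properties as Unique
open import Data.Product using (Σ; _×_; _,_; proj₁; proj₂)
open import Data.Sum using (_⊎_; inj₁; inj₂)
open import Function.Base using (id; _∘_; _on_)
open import Induction.WellFounded using (Acc; acc)
open import Relation.Binary.Definitions using (Decidable; Symmetric)
open import Relation.Binary.PropositionalEquality
open import Relation.Nullary using (¬_; Dec; yes; no; contradiction)
open import Relation.Nullary.Decidable using (¬?; _⊎-dec_; _×-dec_)
open import Relation.Unary.Properties using (∁?)
import Data.Integer as ℤ
import Data.Integer.Properties as ℤ
import Data.Rational as ℚ
import Data.Rational.Properties as ℚ
open import Relation.Binary.Bundles using (DecTotalOrder)
open import Data.List.Extrema (DecTotalOrder.totalOrder ℚ.≤-decTotalOrder)
  using (argmin; argmin-sel; f[argmin]≤f[⊤]; f[argmin]≤f[xs])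
open import Data.Nat.Coprimality using (1-coprimeTo) renaming (sym to coprime-sym)
open import Data.Nat.DivMod using (_/_; _%_; m%n<n; m≡m%n+[m/n]*n)

∑< : ℕ → (ℕ → ℕ) → ℕ
∑< zero    f = 0
∑< (suc n) f = ∑< n f + f n

syntax ∑< n (λ i → e) = ∑[ i < n ] e

∑-cong : ∀ n {f g : ℕ → ℕ} → (∀ {i} → i < n → f i ≡ g i) → ∑< n f ≡ ∑< n g
∑-cong zero    f≗g = refl
∑-cong (suc n) f≗g = cong₂ _+_ (∑-cong n (λ i<n → f≗g (m<n⇒m<1+n i<n))) (f≗g ≤-refl)

∑-+ : ∀ m k (f : ℕ → ℕ) → ∑< (m + k) f ≡ ∑< m f + ∑[ i < k ] f (m + i)
∑-+ m zero    f = trans (cong (λ n → ∑< n f) (+-identityʳ m)) (sym (+-identityʳ _))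
∑-+ m (suc k) f = begin
  ∑< (m + suc k) f                                    ≡⟨ cong (λ n → ∑< n f) (+-suc m k) ⟩
  ∑< (m + k) f + f (m + k)                            ≡⟨ cong (_+ f (m + k)) (∑-+ m k f) ⟩
  ∑< m f + ∑[ i < k ] f (m + i) + f (m + k)           ≡⟨ +-assoc (∑< m f) _ _ ⟩
  ∑< m f + ∑[ i < suc k ] f (m + i)                   ∎
  where open ≡-Reasoning

∑-distrib : ∀ n (f g : ℕ → ℕ) → ∑[ i < n ] (f i + g i) ≡ ∑< n f + ∑< n g
∑-distrib zero    f g = refl
∑-distrib (suc n) f g =
  trans (cong (_+ (f n + g n)) (∑-distrib n f g)) (interchange (∑< n f) (∑< n g) (f n) (g n))

∑-const : ∀ n c → ∑[ i < n ] c ≡ n * c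
∑-const zero    c = refl
∑-const (suc n) c = trans (cong (_+ c) (∑-const n c)) (+-comm (n * c) c)

∑-ones : ∀ n {f : ℕ → ℕ} → (∀ {i} → i < n → f i ≡ 1) → ∑< n f ≡ n
∑-ones n f≗1 = trans (∑-cong n f≗1) (trans (∑-const n 1) (*-identityʳ n))

∑-zeros : ∀ n {f : ℕ → ℕ} → (∀ {i} → i < n → f i ≡ 0) → ∑< n f ≡ 0
∑-zeros n f≗0 = trans (∑-cong n f≗0) (trans (∑-const n 0) (*-zeroʳ n))

∑-mono-≤ : ∀ (f : ℕ → ℕ) {m n} → m ≤ n → ∑< m f ≤ ∑< n f
∑-mono-≤ f {n = zero}  z≤n = ≤-refl
∑-mono-≤ f {m} {suc n} m≤1+n with m≤n⇒m<n∨m≡n m≤1+n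
... | inj₁ m<1+n = ≤-trans (∑-mono-≤ f (s≤s⁻¹ m<1+n)) (m≤m+n _ _)
... | inj₂ refl  = ≤-refl

𝟙 : ∀ {P : Set} → Dec P → ℕ
𝟙 (yes _) = 1
𝟙 (no _)  = 0

𝟙-yes : ∀ {P : Set} (P? : Dec P) → P → 𝟙 P? ≡ 1
𝟙-yes (yes _) _ = refl
𝟙-yes (no ¬p) p = contradiction p ¬p

𝟙-no : ∀ {P : Set} (P? : Dec P) → ¬ P → 𝟙 P? ≡ 0
𝟙-no (yes p) ¬p = contradiction p ¬p
𝟙-no (no _)  _  = refl

𝟙-cong : ∀ {P Q : Set} (P? : Dec P) (Q? : Dec Q) → (P → Q) → (Q → P) → 𝟙 P? ≡ 𝟙 Q?
𝟙-cong (yes _) (yes _) _   _   = refl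
𝟙-cong (yes p) (no ¬q) p→q _   = contradiction (p→q p) ¬q
𝟙-cong (no ¬p) (yes q) _   q→p = contradiction (q→p q) ¬p
𝟙-cong (no _)  (no _)  _   _   = refl

pairCount : {R : ℕ → ℕ → Set} → Decidable R → ℕ → ℕ
pairCount R? n = ∑[ j < n ] ∑[ i < j ] 𝟙 (R? i j)

Join : ℕ → (ℕ → ℕ → Set) → ℕ → ℕ → Set
Join a Q i j = i < a ⊎ (a ≤ i × Q (i ∸ a) (j ∸ a))

join? : ∀ a {Q} → Decidable Q → Decidable (Join a Q)
join? a Q? i j = (i <? a) ⊎-dec ((a ≤? i) ×-dec Q? (i ∸ a) (j ∸ a))

module _ (a : ℕ) {Q : ℕ → ℕ → Set} (Q? : Decidable Q) where

  private
    row : ℕ → ℕ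
    row j = ∑[ i < j ] 𝟙 (join? a Q? i j)

    row-low : ∀ {j} → j < a → row j ≡ j ⊓ a
    row-low {j} j<a = begin
      row j  ≡⟨ ∑-ones j (λ i<j → 𝟙-yes _ (inj₁ (<-trans i<j j<a))) ⟩
      j      ≡⟨ m≤n⇒m⊓n≡m (<⇒≤ j<a) ⟨
      j ⊓ a  ∎
      where open ≡-Reasoning

    row-high : ∀ x → row (a + x) ≡ (a + x) ⊓ a + ∑[ y < x ] 𝟙 (Q? y x)
    row-high x = begin
      row (a + x)                                                     ≡⟨ ∑-+ a x _ ⟩
      ∑[ i < a ] 𝟙 (join? a Q? i (a + x)) + ∑[ y < x ] 𝟙 (join? a Q? (a + y) (a + x))
        ≡⟨ cong₂ _+_ (∑-ones a (λ i<a → 𝟙-yes _ (inj₁ i<a))) (∑-cong x (λ _ → 𝟙-cong _ _ to from)) ⟩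
      a + ∑[ y < x ] 𝟙 (Q? y x)                                       ≡⟨ cong (_+ _) (m≥n⇒m⊓n≡n (m≤m+n a x)) ⟨
      (a + x) ⊓ a + ∑[ y < x ] 𝟙 (Q? y x)                             ∎
      where
      open ≡-Reasoning
      to : ∀ {y} → Join a Q (a + y) (a + x) → Q y x
      to {y} (inj₁ a+y<a)   = contradiction (m≤m+n a y) (<⇒≱ a+y<a)
      to {y} (inj₂ (_ , q)) = subst₂ Q (m+n∸m≡n a y) (m+n∸m≡n a x) q
      from : ∀ {y} → Q y x → Join a Q (a + y) (a + x)
      from {y} q = inj₂ (m≤m+n a y , subst₂ Q (sym (m+n∸m≡n a y)) (sym (m+n∸m≡n a x)) q)

  pairCount-join : ∀ b → pairCount (join? a Q?) (a + b) ≡ ∑[ j < a + b ] (j ⊓ a) + pairCount Q? b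
  pairCount-join b = begin
    ∑[ j < a + b ] row j                                            ≡⟨ ∑-+ a b row ⟩
    ∑[ j < a ] row j + ∑[ x < b ] row (a + x)
      ≡⟨ cong₂ _+_ (∑-cong a row-low) (∑-cong b (λ {x} _ → row-high x)) ⟩
    ∑[ j < a ] (j ⊓ a) + ∑[ x < b ] ((a + x) ⊓ a + ∑[ y < x ] 𝟙 (Q? y x))
      ≡⟨ cong (∑[ j < a ] (j ⊓ a) +_) (∑-distrib b _ _) ⟩
    ∑[ j < a ] (j ⊓ a) + (∑[ x < b ] ((a + x) ⊓ a) + pairCount Q? b) ≡⟨ +-assoc (∑[ j < a ] (j ⊓ a)) _ _ ⟨
    ∑[ j < a ] (j ⊓ a) + ∑[ x < b ] ((a + x) ⊓ a) + pairCount Q? b   ≡⟨ cong (_+ _) (∑-+ a b (_⊓ a)) ⟨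
    ∑[ j < a + b ] (j ⊓ a) + pairCount Q? b                          ∎
    where open ≡-Reasoning

classOf : List ℕ → ℕ → ℕ
classOf []       x = 0
classOf (s ∷ ss) x with x <? sum ss
... | yes _ = suc (classOf ss x)
... | no  _ = 0

classOf-< : ∀ s ss {x} → x < sum ss → classOf (s ∷ ss) x ≡ suc (classOf ss x)
classOf-< s ss {x} x<S with x <? sum ss
... | yes _   = refl
... | no  x≮S = contradiction x<S x≮S

classOf-≥ : ∀ s ss {x} → sum ss ≤ x → classOf (s ∷ ss) x ≡ 0
classOf-≥ s ss {x} S≤x with x <? sum ss
... | yes x<S = contradiction S≤x (<⇒≱ x<S)
... | no  _   = refl

classOf<length : ∀ ss x → 0 < length ss → classOf ss x < length ss
classOf<length (s ∷ ss) x _ with x <? sum ss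
classOf<length (s ∷ [])      x _ | yes ()
classOf<length (s ∷ s′ ∷ ss) x _ | yes _ = s≤s (classOf<length (s′ ∷ ss) x z<s)
classOf<length (s ∷ ss)      x _ | no  _ = z<s

DifferentClass : List ℕ → ℕ → ℕ → Set
DifferentClass ss x y = classOf ss x ≢ classOf ss y

differentClass? : ∀ ss → Decidable (DifferentClass ss)
differentClass? ss x y = ¬? (classOf ss x ≟ classOf ss y)

pairCount-differentClass : ∀ ss → pairCount (differentClass? ss) (sum ss) ≡ multipartiteEdges ss
pairCount-differentClass []       = refl
pairCount-differentClass (s ∷ ss) = begin
  ∑[ j < s + S ] row j                          ≡⟨ cong (λ n → ∑< n row) (+-comm s S) ⟩
  ∑[ j < S + s ] row j                          ≡⟨ ∑-+ S s row ⟩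
  ∑[ j < S ] row j + ∑[ x < s ] row (S + x)
    ≡⟨ cong₂ _+_ (∑-cong S row-inner) (∑-cong s (λ {x} _ → row-outer x)) ⟩
  pairCount (differentClass? ss) S + ∑[ x < s ] S ≡⟨ cong₂ _+_ (pairCount-differentClass ss) (∑-const s S) ⟩
  multipartiteEdges ss + s * S                  ≡⟨ +-comm _ (s * S) ⟩
  s * S + multipartiteEdges ss                  ∎
  where
  open ≡-Reasoning
  S = sum ss
  row : ℕ → ℕ
  row j = ∑[ i < j ] 𝟙 (differentClass? (s ∷ ss) i j)

  row-inner : ∀ {j} → j < S → row j ≡ ∑[ i < j ] 𝟙 (differentClass? ss i j)
  row-inner {j} j<S = ∑-cong j (λ i<j → 𝟙-cong _ _
    (λ ne eq → ne (trans (shifted (<-trans i<j j<S)) (trans (cong suc eq) (sym (shifted j<S)))))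
    (λ ne eq → ne (suc-injective (trans (sym (shifted (<-trans i<j j<S))) (trans eq (shifted j<S))))))
    where
    shifted : ∀ {i} → i < S → classOf (s ∷ ss) i ≡ suc (classOf ss i)
    shifted = classOf-< s ss

  outer : ∀ x → classOf (s ∷ ss) (S + x) ≡ 0
  outer x = classOf-≥ s ss (m≤m+n S x)

  row-outer : ∀ x → row (S + x) ≡ S
  row-outer x = begin
    row (S + x)                                                                   ≡⟨ ∑-+ S x _ ⟩
    ∑[ i < S ] 𝟙 (differentClass? (s ∷ ss) i (S + x))
      + ∑[ y < x ] 𝟙 (differentClass? (s ∷ ss) (S + y) (S + x))
      ≡⟨ cong₂ _+_ (∑-ones S (λ i<S → 𝟙-yes _ (λ eq → 0≢1+n (trans (sym (outer x)) (trans (sym eq) (classOf-< s ss i<S))))))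
                   (∑-zeros x (λ {y} _ → 𝟙-no _ (λ ne → ne (trans (outer y) (sym (outer x)))))) ⟩
    S + 0                                                                         ≡⟨ +-identityʳ S ⟩
    S                                                                             ∎

sum-replicate : ∀ r x → sum (replicate r x) ≡ r * x
sum-replicate zero    x = refl
sum-replicate (suc r) x = cong (x +_) (sum-replicate r x)

length-turanSizes : ∀ n m → length (turanSizes n m) ≡ m
length-turanSizes n zero    = refl
length-turanSizes n (suc m) = begin
  length (replicate r (suc q) ++ replicate (suc m ∸ r) q) ≡⟨ length-++ (replicate r (suc q)) ⟩
  length (replicate r (suc q)) + length (replicate (suc m ∸ r) q)
    ≡⟨ cong₂ _+_ (length-replicate r) (length-replicate (suc m ∸ r)) ⟩
  r + (suc m ∸ r)                                          ≡⟨ m+[n∸m]≡n (<⇒≤ (m%n<n n (suc m))) ⟩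
  suc m                                                    ∎
  where
  open ≡-Reasoning
  r = n % suc m
  q = n / suc m

sum-turanSizes : ∀ n {m} → 0 < m → sum (turanSizes n m) ≡ n
sum-turanSizes n {suc m} _ = begin
  sum (replicate r (suc q) ++ replicate (D ∸ r) q)        ≡⟨ sum-++ (replicate r (suc q)) _ ⟩
  sum (replicate r (suc q)) + sum (replicate (D ∸ r) q)
    ≡⟨ cong₂ _+_ (sum-replicate r (suc q)) (sum-replicate (D ∸ r) q) ⟩
  r * suc q + (D ∸ r) * q                                 ≡⟨ cong (_+ (D ∸ r) * q) (*-suc r q) ⟩
  r + r * q + (D ∸ r) * q                                 ≡⟨ +-assoc r (r * q) _ ⟩
  r + (r * q + (D ∸ r) * q)                               ≡⟨ cong (r +_) (*-distribʳ-+ q r (D ∸ r)) ⟨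
  r + (r + (D ∸ r)) * q                                   ≡⟨ cong (λ z → r + z * q) (m+[n∸m]≡n (<⇒≤ (m%n<n n D))) ⟩
  r + D * q                                               ≡⟨ cong (r +_) (*-comm D q) ⟩
  r + q * D                                               ≡⟨ m≡m%n+[m/n]*n n D ⟨
  n                                                       ∎
  where
  open ≡-Reasoning
  D = suc m
  r = n % D
  q = n / D

module _ {A : Set} where

  lookup-injective : ∀ {xs : List A} → Unique xs → ∀ {i j} → lookup xs i ≡ lookup xs j → i ≡ j
  lookup-injective (_   ∷ _)  {Fin.zero}  {Fin.zero}  _  = refl
  lookup-injective (x∉ ∷ _)   {Fin.zero}  {Fin.suc j} eq = contradiction eq (All.lookup x∉ (∈-lookup j))
  lookup-injective (x∉ ∷ _)   {Fin.suc i} {Fin.zero}  eq = contradiction (sym eq) (All.lookup x∉ (∈-lookup i))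
  lookup-injective (_  ∷ xs!) {Fin.suc i} {Fin.suc j} eq = cong Fin.suc (lookup-injective xs! eq)

  length-≤-⊆ : ∀ {xs ys : List A} → Unique xs → xs ⊆ ys → length xs ≤ length ys
  length-≤-⊆ {xs} {ys} xs! xs⊆ys = Fin.injective⇒≤ (λ {i} {j} eq → lookup-injective xs! (begin
    lookup xs i                      ≡⟨ lookup-index (xs⊆ys (∈-lookup i)) ⟩
    lookup ys (index (xs⊆ys (∈-lookup i))) ≡⟨ cong (lookup ys) eq ⟩
    lookup ys (index (xs⊆ys (∈-lookup j))) ≡⟨ lookup-index (xs⊆ys (∈-lookup j)) ⟨
    lookup xs j                      ∎))
    where open ≡-Reasoning

  unique-map⁺ : ∀ {B : Set} {P : A → Set} (f : A → B) → (∀ {x y} → P x → P y → f x ≡ f y → x ≡ y) →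
                ∀ {xs} → All P xs → Unique xs → Unique (map f xs)
  unique-map⁺ f inj []         []         = []
  unique-map⁺ f inj (px ∷ pxs) (x∉ ∷ xs!) =
    All.map⁺ (All.zipWith (λ (x≢y , py) fx≡fy → x≢y (inj px py fx≡fy)) (x∉ , pxs)) ∷ unique-map⁺ f inj pxs xs!

  length-filter+filter : ∀ {P : A → Set} (P? : ∀ x → Dec (P x)) xs →
                         length xs ≡ length (filter P? xs) + length (filter (∁? P?) xs)
  length-filter+filter P? []       = refl
  length-filter+filter P? (x ∷ xs) with P? x
  ... | yes _ = cong suc (length-filter+filter P? xs)
  ... | no  _ = trans (cong suc (length-filter+filter P? xs)) (sym (+-suc _ _))

noCommonPoint⇒length≤ : ∀ {n d K} (F : Family n d) → NoCommonPoint K F →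
  ∀ {S} → Unique S → (p : Point d) → All (λ i → p ∈ᴮ F i) S → length S ≤ K
noCommonPoint⇒length≤ {K = K} F noCommon {S} S! p p∈S with length S ≤? K
... | yes |S|≤K = |S|≤K
... | no  |S|≰K =
  contradiction (p , All.take⁺ (suc K) p∈S) (noCommon (take (suc K) S) (Unique.take⁺ (suc K) S!) |take|)
  where
  |take| : length (take (suc K) S) ≡ suc K
  |take| = trans (length-take (suc K) S) (m≤n⇒m⊓n≡m (≰⇒> |S|≰K))

Meets-sym : ∀ {n d} (F : Family n d) → Symmetric (Meets F)
Meets-sym F (p , p∈i , p∈j) = p , p∈j , p∈i

module _ {n : ℕ} where

  Edge : (Fin n → Fin n → Set) → Pair n → Set
  Edge _~_ (i , j , _) = i ~ j

  Within : List (Fin n) → Pair n → Set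
  Within S (i , j , _) = i ∈ S × j ∈ S

  Through : Fin n → Pair n → Set
  Through m (i , j , _) = i ≡ m ⊎ j ≡ m

  through? : ∀ m p → Dec (Through m p)
  through? m (i , j , _) = (i Fin.≟ m) ⊎-dec (j Fin.≟ m)

  other : Fin n → Pair n → Fin n
  other m (i , j , _) with i Fin.≟ m
  ... | yes _ = j
  ... | no  _ = i

  other-≢ : ∀ m p → other m p ≢ m
  other-≢ m (i , j , i<j) with i Fin.≟ m
  ... | yes refl = λ { refl → Fin.<-irrefl refl i<j }
  ... | no  i≢m  = i≢m

  other-∈ : ∀ m {S} p → Within S p → other m p ∈ S
  other-∈ m (i , j , _) (i∈S , j∈S) with i Fin.≟ m
  ... | yes _ = j∈S
  ... | no  _ = i∈S

  other-~ : ∀ {_~_} → Symmetric _~_ → ∀ m p → Through m p → Edge _~_ p → m ~ other m p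
  other-~ ~-sym m (i , j , _) _           i~j with i Fin.≟ m
  other-~ ~-sym m (i , j , _) _           i~j | yes refl = i~j
  other-~ ~-sym m (i , j , _) (inj₁ i≡m)  i~j | no  i≢m  = contradiction i≡m i≢m
  other-~ ~-sym m (i , j , _) (inj₂ refl) i~j | no  _    = ~-sym i~j

  private
    pair-≡ : ∀ {i j i′ j′} (i<j : i Fin.< j) (i′<j′ : i′ Fin.< j′) → i ≡ i′ → j ≡ j′ →
             _≡_ {A = Pair n} (i , j , i<j) (i′ , j′ , i′<j′)
    pair-≡ i<j i′<j′ refl refl = cong (λ lt → _ , _ , lt) (Fin.<-irrelevant i<j i′<j′)

  other-injective : ∀ m {p q} → Through m p → Through m q → other m p ≡ other m q → p ≡ q
  other-injective m {i , j , i<j} {i′ , j′ , i′<j′} thp thq eq with i Fin.≟ m | i′ Fin.≟ m | thp | thq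
  ... | yes refl | yes refl | _          | _           = pair-≡ i<j i′<j′ refl eq
  ... | yes refl | no  i′≢m | _          | inj₁ i′≡m   = contradiction i′≡m i′≢m
  ... | yes refl | no  _    | _          | inj₂ refl   = contradiction (subst (Fin._< i) (sym eq) i′<j′) (Fin.<-asym i<j)
  ... | no  i≢m  | yes refl | inj₁ i≡m   | _           = contradiction i≡m i≢m
  ... | no  _    | yes refl | inj₂ refl  | _           = contradiction (subst (Fin._< i′) eq i<j) (Fin.<-asym i′<j′)
  ... | no  i≢m  | no  _    | inj₁ i≡m   | _           = contradiction i≡m i≢m
  ... | no  _    | no  i′≢m | _          | inj₁ i′≡m   = contradiction i′≡m i′≢m
  ... | no  _    | no  _    | inj₂ refl  | inj₂ refl   = pair-≡ i<j i′<j′ eq refl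

≢? : ∀ {n} (m j : Fin n) → Dec (j ≢ m)
≢? m j = ¬? (j Fin.≟ m)

without : ∀ {n} → Fin n → List (Fin n) → List (Fin n)
without m = filter (≢? m)

FewNeighbours : ∀ {n} → (Fin n → Fin n → Set) → ℕ → List (Fin n) → Fin n → Set
FewNeighbours _~_ a S m = ∀ L → Unique L → All (λ j → j ∈ S × j ≢ m × m ~ j) L → length L ≤ a

IsDegenerate : ∀ {n} → (Fin n → Fin n → Set) → ℕ → Set
IsDegenerate {n} _~_ a = ∀ x S → Σ (Fin n) λ m → m ∈ x ∷ S × FewNeighbours _~_ a (x ∷ S) m

module _ {n a} {_~_ : Fin n → Fin n → Set} (~-sym : Symmetric _~_) (degenerate : IsDegenerate _~_ a) where

  private
    star-≤ : ∀ {S m} → FewNeighbours _~_ a S m → ∀ {qs} → Unique qs → All (Through m) qs →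
             All (Edge _~_) qs → All (Within S) qs → length qs ≤ length (without m S) ⊓ a
    star-≤ {S} {m} few {qs} qs! through edges within = begin
      length qs                     ≡⟨ length-map (other m) qs ⟨
      length (map (other m) qs)     ≤⟨ ⊓-glb (length-≤-⊆ others! (All.lookup in-S′)) (few _ others! nbrs) ⟩
      length (without m S) ⊓ a      ∎
      where
      open ≤-Reasoning
      others! : Unique (map (other m) qs)
      others! = unique-map⁺ (other m) (other-injective m) through qs!
      nbrs : All (λ j → j ∈ S × j ≢ m × m ~ j) (map (other m) qs)
      nbrs = All.map⁺ (All.zipWith (λ {p} ((th , e) , w) → other-∈ m p w , other-≢ m p , other-~ ~-sym m p th e)
                        (All.zip (through , edges) , within))
      in-S′ : All (_∈ without m S) (map (other m) qs)
      in-S′ = All.map (λ (j∈S , j≢m , _) → ∈-filter⁺ (≢? m) j∈S j≢m) nbrs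

  edgesWithin-≤ : ∀ S → Acc _<_ (length S) → ∀ {ps} → Unique ps → All (Edge _~_) ps → All (Within S) ps →
                  length ps ≤ ∑[ j < length S ] (j ⊓ a)
  edgesWithin-≤ []       _         {[]}    _   _     _                    = z≤n
  edgesWithin-≤ []       _         {_ ∷ _} _   _     ((() , _) ∷ _)
  edgesWithin-≤ (x ∷ S₀) (acc rec) {ps}    ps! edges within with degenerate x S₀
  ... | m , m∈S , few = begin
    length ps                                      ≡⟨ length-filter+filter (through? m) ps ⟩
    length star + length rest                      ≤⟨ +-mono-≤ star-bound rest-bound ⟩
    length S′ ⊓ a + ∑[ j < length S′ ] (j ⊓ a)     ≡⟨ +-comm (length S′ ⊓ a) _ ⟩
    ∑[ j < suc (length S′) ] (j ⊓ a)               ≤⟨ ∑-mono-≤ (_⊓ a) S′<S ⟩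
    ∑[ j < length S ] (j ⊓ a)                      ∎
    where
    open ≤-Reasoning
    S = x ∷ S₀
    S′ = without m S
    star = filter (through? m) ps
    rest = filter (∁? (through? m)) ps
    S′<S : length S′ < length S
    S′<S = filter-notAll (≢? m) S (Any.map (λ m≡j m≢j → m≢j (sym m≡j)) m∈S)
    star-bound : length star ≤ length S′ ⊓ a
    star-bound = star-≤ few (Unique.filter⁺ _ ps!) (All.all-filter _ ps) (All.filter⁺ _ edges) (All.filter⁺ _ within)
    avoids : ∀ {p} → ¬ Through m p → Within S p → Within S′ p
    avoids {i , j , _} ¬th (i∈S , j∈S) =
      ∈-filter⁺ (≢? m) i∈S (¬th ∘ inj₁) , ∈-filter⁺ (≢? m) j∈S (¬th ∘ inj₂)
    rest-bound : length rest ≤ ∑[ j < length S′ ] (j ⊓ a)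
    rest-bound = edgesWithin-≤ S′ (rec S′<S) (Unique.filter⁺ _ ps!) (All.filter⁺ _ edges)
      (All.map (λ {p} (¬th , w) → avoids {p} ¬th w) (All.zip (All.all-filter (∁? (through? m)) ps , All.filter⁺ _ within)))

  edges-≤ : ∀ {ps} → Unique ps → All (Edge _~_) ps → length ps ≤ ∑[ j < n ] (j ⊓ a)
  edges-≤ {ps} ps! edges = subst (λ N → length ps ≤ ∑[ j < N ] (j ⊓ a)) (length-tabulate {n = n} id)
    (edgesWithin-≤ (allFin n) (<-wellFounded _) ps! edges (All.universal (λ (i , j , _) → ∈-allFin i , ∈-allFin j) _))

intervals-degenerate : ∀ {n a} (F : Family n 1) → NoCommonPoint (suc a) F → IsDegenerate (Meets F) a
intervals-degenerate {n} {a} F noCommon x S = m , m∈S , few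
  where
  right : Fin n → ℚ.ℚ
  right i = hi (F i Fin.zero)
  m = argmin right x S
  m∈S : m ∈ x ∷ S
  m∈S with argmin-sel right x S
  ... | inj₁ m≡x = here m≡x
  ... | inj₂ m∈S = there m∈S
  minimal : All (λ j → right m ℚ.≤ right j) (x ∷ S)
  minimal = f[argmin]≤f[⊤] {f = right} x S ∷ f[argmin]≤f[xs] {f = right} x S
  corner : Point 1
  corner _ = right m
  corner∈m : corner ∈ᴮ F m
  corner∈m Fin.zero = lo≤hi (F m Fin.zero) , ℚ.≤-refl
  corner∈ : ∀ {j} → j ∈ x ∷ S → Meets F m j → corner ∈ᴮ F j
  corner∈ j∈S (p , p∈m , p∈j) Fin.zero =
    ℚ.≤-trans (proj₁ (p∈j Fin.zero)) (proj₂ (p∈m Fin.zero)) , All.lookup minimal j∈S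
  few : FewNeighbours (Meets F) a (x ∷ S) m
  few L L! nbrs = s≤s⁻¹ (noCommonPoint⇒length≤ F noCommon (All.map (λ (_ , j≢m , _) → j≢m ∘ sym) nbrs ∷ L!) corner
    (corner∈m ∷ All.map (λ (j∈S , _ , m~j) → corner∈ j∈S m~j) nbrs))

T-intervals-≤ : ∀ {n a T} → IsT n (suc a) 1 T → T ≤ ∑[ j < n ] (j ⊓ a)
T-intervals-≤ ((F , noCommon , ps , ps! , intersecting , |ps|≡T) , _) =
  subst (_≤ _) |ps|≡T (edges-≤ (Meets-sym F) (intervals-degenerate F noCommon) ps! intersecting)

module _ {R : ℕ → ℕ → Set} (R? : Decidable R) {N : ℕ} where

  private
    pair : ∀ {i j} → i < j → j < N → Pair N
    pair i<j j<N = fromℕ< (<-trans i<j j<N) , fromℕ< j<N ,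
      subst₂ _<_ (sym (Fin.toℕ-fromℕ< (<-trans i<j j<N))) (sym (Fin.toℕ-fromℕ< j<N)) i<j

    InRow : ℕ → ℕ → Pair N → Set
    InRow i j (i′ , j′ , _) = R (toℕ i′) (toℕ j′) × toℕ i′ < i × toℕ j′ ≡ j

    pair-inRow : ∀ {i j} (i<j : i < j) (j<N : j < N) → R i j → InRow (suc i) j (pair i<j j<N)
    pair-inRow i<j j<N r = subst₂ R (sym (Fin.toℕ-fromℕ< _)) (sym (Fin.toℕ-fromℕ< j<N)) r ,
                           s≤s (≤-reflexive (Fin.toℕ-fromℕ< _)) , Fin.toℕ-fromℕ< j<N

    inRow-suc : ∀ {i j p} → InRow i j p → InRow (suc i) j p
    inRow-suc (r , i′<i , j′≡j) = r , m<n⇒m<1+n i′<i , j′≡j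

    row : ∀ {j} → j < N → ∀ i → i ≤ j → List (Pair N)
    row         j<N zero    _     = []
    row {j = j} j<N (suc i) 1+i≤j with R? i j
    ... | yes _ = pair 1+i≤j j<N ∷ row j<N i (<⇒≤ 1+i≤j)
    ... | no  _ = row j<N i (<⇒≤ 1+i≤j)

    row-length : ∀ {j} (j<N : j < N) i i≤j → length (row j<N i i≤j) ≡ ∑[ i′ < i ] 𝟙 (R? i′ j)
    row-length         j<N zero    _     = refl
    row-length {j = j} j<N (suc i) 1+i≤j with R? i j
    ... | yes _ = trans (cong suc (row-length j<N i _)) (+-comm 1 _)
    ... | no  _ = trans (row-length j<N i _) (sym (+-identityʳ _))

    row-inRow : ∀ {j} (j<N : j < N) i i≤j → All (InRow i j) (row j<N i i≤j)
    row-inRow         j<N zero    _     = []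
    row-inRow {j = j} j<N (suc i) 1+i≤j with R? i j
    ... | yes r = pair-inRow 1+i≤j j<N r ∷ All.map (λ {p} → inRow-suc {i} {j} {p}) (row-inRow j<N i _)
    ... | no  _ = All.map (λ {p} → inRow-suc {i} {j} {p}) (row-inRow j<N i _)

    row-unique : ∀ {j} (j<N : j < N) i i≤j → Unique (row j<N i i≤j)
    row-unique         j<N zero    _     = []
    row-unique {j = j} j<N (suc i) 1+i≤j with R? i j
    ... | yes _ = All.map (λ (_ , i′<i , _) eq → <-irrefl (trans (cong (toℕ ∘ proj₁) (sym eq)) (Fin.toℕ-fromℕ< _)) i′<i)
                    (row-inRow j<N i _)
                  ∷ row-unique j<N i _
    ... | no  _ = row-unique j<N i _

    rows : ∀ m → m ≤ N → List (Pair N)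
    rows zero    _   = []
    rows (suc j) j<N = row j<N j ≤-refl ++ rows j (<⇒≤ j<N)

    rows-length : ∀ m m≤N → length (rows m m≤N) ≡ pairCount R? m
    rows-length zero    _   = refl
    rows-length (suc j) j<N = trans (length-++ (row j<N j ≤-refl))
      (trans (cong₂ _+_ (row-length j<N j ≤-refl) (rows-length j (<⇒≤ j<N))) (+-comm _ (pairCount R? j)))

    rows-below : ∀ m m≤N → All (λ p → Edge (R on toℕ) p × toℕ (proj₁ (proj₂ p)) < m) (rows m m≤N)
    rows-below zero    _   = []
    rows-below (suc j) j<N = All.++⁺
      (All.map (λ (r , _ , j′≡j) → r , s≤s (≤-reflexive j′≡j)) (row-inRow j<N j ≤-refl))
      (All.map (λ (r , j′<j) → r , m<n⇒m<1+n j′<j) (rows-below j (<⇒≤ j<N)))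

    rows-unique : ∀ m m≤N → Unique (rows m m≤N)
    rows-unique zero    _   = []
    rows-unique (suc j) j<N = AllPairs.++⁺ (row-unique j<N j ≤-refl) (rows-unique j (<⇒≤ j<N))
      (All.map (λ (_ , _ , j′≡j) → All.map (λ (_ , j″<j) eq → <-irrefl (trans (cong (toℕ ∘ proj₁ ∘ proj₂) (sym eq)) j′≡j) j″<j)
                 (rows-below j (<⇒≤ j<N)))
        (row-inRow j<N j ≤-refl))

  enumerate : Σ (List (Pair N)) λ ps → Unique ps × All (Edge (R on toℕ)) ps × length ps ≡ pairCount R? N
  enumerate = rows N ≤-refl , rows-unique N ≤-refl , All.map proj₁ (rows-below N ≤-refl) , rows-length N ≤-refl

fromℕ : ℕ → ℚ.ℚ
fromℕ x = ℚ.mkℚ (ℤ.+ x) 0 (coprime-sym (1-coprimeTo x))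

fromℕ-mono-≤ : ∀ {x y} → x ≤ y → fromℕ x ℚ.≤ fromℕ y
fromℕ-mono-≤ {x} {y} x≤y =
  ℚ.*≤* (subst₂ ℤ._≤_ (sym (ℤ.*-identityʳ (ℤ.+ x))) (sym (ℤ.*-identityʳ (ℤ.+ y))) (ℤ.+≤+ x≤y))

fromℕ-injective : ∀ {x y} → fromℕ x ≡ fromℕ y → x ≡ y
fromℕ-injective eq = ℤ.+-injective (cong ℚ.ℚ.numerator eq)

module PinnedBoxes (N a d : ℕ) (col : ℕ → ℕ) (col<d : ∀ x → col x < d) where

  full : Interval
  full = [ fromℕ 0 , fromℕ N ]⟨ fromℕ-mono-≤ z≤n ⟩

  singleton : ℕ → Interval
  singleton x = [ fromℕ x , fromℕ x ]⟨ ℚ.≤-refl ⟩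

  Pinned : ℕ → Fin d → Set
  Pinned i c = a ≤ i × toℕ c ≡ col (i ∸ a)

  pinned? : ∀ i c → Dec (Pinned i c)
  pinned? i c = (a ≤? i) ×-dec (toℕ c ≟ col (i ∸ a))

  pinIf : ∀ {P : Set} → Dec P → ℕ → Interval
  pinIf (yes _) x = singleton x
  pinIf (no  _) _ = full

  box : ℕ → Box d
  box i c = pinIf (pinned? i c) (i ∸ a)

  boxes : Family N d
  boxes i = box (toℕ i)

  ∈-full : ∀ {x} → x ≤ N → fromℕ x ∈ᴵ full
  ∈-full x≤N = fromℕ-mono-≤ z≤n , fromℕ-mono-≤ x≤N

  ∈-box⁺ : ∀ {i} {p : Point d} → (∀ c → p c ∈ᴵ full) → (∀ {c} → Pinned i c → p c ≡ fromℕ (i ∸ a)) →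
           p ∈ᴮ box i
  ∈-box⁺ {i} p∈full pin c with pinned? i c
  ... | yes pinned = ℚ.≤-reflexive (sym (pin pinned)) , ℚ.≤-reflexive (pin pinned)
  ... | no  _      = p∈full c

  ∈-box⁻ : ∀ {i c} {p : Point d} → p ∈ᴮ box i → Pinned i c → p c ≡ fromℕ (i ∸ a)
  ∈-box⁻ {i} {c} p∈box pinned with pinned? i c | p∈box c
  ... | yes _       | lo≤p , p≤hi = ℚ.≤-antisym p≤hi lo≤p
  ... | no  ¬pinned | _           = contradiction pinned ¬pinned

  Crossing : ℕ → ℕ → Set
  Crossing = Join a (λ x y → col x ≢ col y)

  box-meets : ∀ {i j} → i < N → j < N → Crossing i j → Σ (Point d) λ p → p ∈ᴮ box i × p ∈ᴮ box j
  box-meets {i} {j} i<N j<N crossing = witness , ∈-box⁺ ∈full (at-i crossing) , ∈-box⁺ ∈full at-j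
    where
    witness : Point d
    witness c with toℕ c ≟ col (j ∸ a)
    ... | yes _ = fromℕ (j ∸ a)
    ... | no  _ = fromℕ (i ∸ a)
    ∸a≤N : ∀ {k} → k < N → k ∸ a ≤ N
    ∸a≤N k<N = ≤-trans (m∸n≤m _ a) (<⇒≤ k<N)
    ∈full : ∀ c → witness c ∈ᴵ full
    ∈full c with toℕ c ≟ col (j ∸ a)
    ... | yes _ = ∈-full (∸a≤N j<N)
    ... | no  _ = ∈-full (∸a≤N i<N)
    at-j : ∀ {c} → Pinned j c → witness c ≡ fromℕ (j ∸ a)
    at-j {c} (_ , c≡col) with toℕ c ≟ col (j ∸ a)
    ... | yes _   = refl
    ... | no  c≢col = contradiction c≡col c≢col
    at-i : Crossing i j → ∀ {c} → Pinned i c → witness c ≡ fromℕ (i ∸ a)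
    at-i crossing {c} (a≤i , c≡colᵢ) with toℕ c ≟ col (j ∸ a) | crossing
    ... | no  _      | _                 = refl
    ... | yes _      | inj₁ i<a          = contradiction a≤i (<⇒≱ i<a)
    ... | yes c≡colⱼ | inj₂ (_ , colᵢ≢colⱼ) = contradiction (trans (sym c≡colᵢ) c≡colⱼ) colᵢ≢colⱼ

  label : ℕ → ℕ
  label i with i <? a
  ... | yes _ = i
  ... | no  _ = a + col (i ∸ a)

  label<a+d : ∀ i → label i < a + d
  label<a+d i with i <? a
  ... | yes i<a = ≤-trans i<a (m≤m+n a d)
  ... | no  _   = +-monoʳ-< a (col<d (i ∸ a))

  label-injective : ∀ {i j} (p : Point d) → p ∈ᴮ box i → p ∈ᴮ box j → label i ≡ label j → i ≡ j
  label-injective {i} {j} p p∈i p∈j eq with i <? a | j <? a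
  ... | yes _   | yes _   = eq
  ... | yes i<a | no  _   = contradiction (subst (a ≤_) (sym eq) (m≤m+n a _)) (<⇒≱ i<a)
  ... | no  _   | yes j<a = contradiction (subst (a ≤_) eq (m≤m+n a _)) (<⇒≱ j<a)
  ... | no  i≮a | no  j≮a = begin
    i            ≡⟨ m+[n∸m]≡n (≮⇒≥ i≮a) ⟨
    a + (i ∸ a)  ≡⟨ cong (a +_) (fromℕ-injective (trans (sym (∈-box⁻ p∈i pinnedᵢ)) (∈-box⁻ p∈j pinnedⱼ))) ⟩
    a + (j ∸ a)  ≡⟨ m+[n∸m]≡n (≮⇒≥ j≮a) ⟩
    j            ∎
    where
    open ≡-Reasoning
    c : Fin d
    c = fromℕ< (col<d (i ∸ a))
    pinnedᵢ : Pinned i c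
    pinnedᵢ = ≮⇒≥ i≮a , Fin.toℕ-fromℕ< (col<d (i ∸ a))
    pinnedⱼ : Pinned j c
    pinnedⱼ = ≮⇒≥ j≮a , trans (Fin.toℕ-fromℕ< (col<d (i ∸ a))) (+-cancelˡ-≡ a _ _ eq)

  boxes-noCommonPoint : NoCommonPoint (a + d) boxes
  boxes-noCommonPoint S S! |S|≡1+a+d (p , p∈S) = 1+n≰n (begin
    suc (a + d)            ≡⟨ trans (length-map labelᶠ S) |S|≡1+a+d ⟨
    length (map labelᶠ S)  ≤⟨ length-≤-⊆ labels! (All.lookup labels<) ⟩
    length (upTo (a + d))  ≡⟨ length-upTo (a + d) ⟩
    a + d                  ∎)
    where
    open ≤-Reasoning
    labelᶠ : Fin N → ℕ
    labelᶠ i = label (toℕ i)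
    labels! : Unique (map labelᶠ S)
    labels! = unique-map⁺ labelᶠ (λ p∈i p∈j eq → Fin.toℕ-injective (label-injective p p∈i p∈j eq)) p∈S S!
    labels< : All (_∈ upTo (a + d)) (map labelᶠ S)
    labels< = All.map⁺ (All.universal (λ i → ∈-upTo⁺ (label<a+d (toℕ i))) S)

  crossing? : Decidable Crossing
  crossing? = join? a (λ x y → ¬? (col x ≟ col y))

  boxes-atLeastPairs : AtLeastPairs boxes (pairCount crossing? N)
  boxes-atLeastPairs with enumerate crossing? {N}
  ... | ps , ps! , crossing , |ps| = ps , ps! , All.map (λ {(u , v , _)} → box-meets (Fin.toℕ<n u) (Fin.toℕ<n v)) crossing , |ps|

atLeastPairs⇒≤ : ∀ {n k d T} → IsT n k d T → (F : Family n d) → NoCommonPoint k F →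
                 ∀ {m} → AtLeastPairs F m → m ≤ T
atLeastPairs⇒≤ (_ , maximal) F noCommon (ps , ps! , intersecting , refl) = maximal F noCommon ps ps! intersecting

T-boxes-≥ : ∀ a b {d} → 0 < d → ∀ {T} → IsT (a + b) (a + d) d T → ∑[ j < a + b ] (j ⊓ a) + t b d ≤ T
T-boxes-≥ a b {d} 0<d {T} isT = begin
  ∑[ j < a + b ] (j ⊓ a) + t b d                              ≡⟨ cong (∑[ j < a + b ] (j ⊓ a) +_) t≡pairCount ⟩
  ∑[ j < a + b ] (j ⊓ a) + pairCount (differentClass? ss) b   ≡⟨ pairCount-join a (differentClass? ss) b ⟨
  pairCount crossing? (a + b)                                 ≤⟨ atLeastPairs⇒≤ isT boxes boxes-noCommonPoint boxes-atLeastPairs ⟩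
  T                                                           ∎
  where
  open ≤-Reasoning
  ss = turanSizes b d
  |ss| = length-turanSizes b d
  open PinnedBoxes (a + b) a d (classOf ss)
    (λ x → subst (classOf ss x <_) |ss| (classOf<length ss x (subst (0 <_) (sym |ss|) 0<d)))
  t≡pairCount : t b d ≡ pairCount (differentClass? ss) b
  t≡pairCount = trans (sym (pairCount-differentClass ss)) (cong (pairCount (differentClass? ss)) (sum-turanSizes b 0<d))

proposition3 : (n k d : ℕ) → 1 ≤ d → d < k → k ≤ n →
    (T₁ Tₖ : ℕ) → IsT n (suc k ∸ d) 1 T₁ → IsT n k d Tₖ →
    t (n ∸ k + d) d + T₁ ≤ Tₖ
proposition3 n k d 0<d d<k k≤n T₁ Tₖ isT₁ isTₖ = begin
  t b d + T₁                      ≤⟨ +-monoʳ-≤ (t b d) (T-intervals-≤ isT₁′) ⟩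
  t b d + ∑[ j < n ] (j ⊓ a)      ≡⟨ +-comm (t b d) _ ⟩
  ∑[ j < n ] (j ⊓ a) + t b d      ≡⟨ cong (λ m → ∑[ j < m ] (j ⊓ a) + t b d) a+b≡n ⟨
  ∑[ j < a + b ] (j ⊓ a) + t b d  ≤⟨ T-boxes-≥ a b 0<d isTₖ′ ⟩
  Tₖ                              ∎
  where
  open ≤-Reasoning
  d≤k = <⇒≤ d<k
  a = k ∸ d
  b = n ∸ k + d
  a+d≡k : a + d ≡ k
  a+d≡k = m∸n+n≡m d≤k
  a+b≡n : a + b ≡ n
  a+b≡n = begin-equality
    a + (n ∸ k + d)   ≡⟨ cong (a +_) (+-comm (n ∸ k) d) ⟩
    a + (d + (n ∸ k)) ≡⟨ +-assoc a d (n ∸ k) ⟨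
    a + d + (n ∸ k)   ≡⟨ cong (_+ (n ∸ k)) a+d≡k ⟩
    k + (n ∸ k)       ≡⟨ m+[n∸m]≡n k≤n ⟩
    n                 ∎
  isT₁′ : IsT n (suc a) 1 T₁
  isT₁′ = subst (λ K → IsT n K 1 T₁) (+-∸-assoc 1 d≤k) isT₁
  isTₖ′ : IsT (a + b) (a + d) d Tₖ
  isTₖ′ = subst₂ (λ m K → IsT m K d Tₖ) (sym a+b≡n) (sym a+d≡k) isTₖ
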